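{- Let $G$ be a closed subgroup of $\mathrm{Sym}(D)$ containing $\mathrm{Aut}(D,E)$. Then $T(G)$ is a closed subgroup of $\mathrm{Sym}(T)$ containing $\mathrm{Aut}(T,E_T)$.
   Context: $(D,E)$ is the generic digraph: the unique up to isomorphism countable homogeneous digraph (irreflexive antisymmetric edge relation $E$) into which every finite digraph embeds. $(T,E_T)$ is the random tournament: the countable homogeneous tournament embedding all finite tournaments. Symmetric groups carry the topology of pointwise convergence. For tuples $\bar a=(a_1,\dots,a_n)$, $\bar b=(b_1,\dots,b_n)$ in digraphs, $\bar a\cong\bar b$ means $a_i\mapsto b_i$ is a well-defined isomorphism of induced subdigraphs. $T(G)$ is the set of $f\in\mathrm{Sym}(T)$ such that for every finite tuple $\bar a$ from $T$ there exist $g\in G$ and a tuple $\bar b$ from $D$ with $\bar a\cong\bar b$ and $f(\bar a)\cong g(\bar b)$. -}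

module Defs where

open import Level using (Level; suc; _⊔_)
open import Data.Nat using (ℕ)
open import Data.Fin using (Fin)
open import Data.Product using (Σ; _×_; ∃; ∃-syntax)
open import Data.Sum using (_⊎_)
open import Relation.Nullary using (¬_)
open import Relation.Binary.PropositionalEquality using (_≡_)
open import Function using (_∘_)
open import Function.Bundles using (_↔_; _⇔_; Inverse)
open import Function.Definitions using (Injective)
open import Function.Construct.Identity using (↔-id)
open import Function.Construct.Composition using (_↔-∘_)
open import Function.Construct.Symmetry using (↔-sym)

-- Countable structures live on the carrier ℕ.  A binary relation on a
-- carrier X is any  X → X → Set.

Rel₀ : Set → Set₁
Rel₀ X = X → X → Set

IsDigraph : {X : Set} → Rel₀ X → Set
IsDigraph {X} E = (∀ x → ¬ E x x) × (∀ x y → E x y → ¬ E y x)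

IsTournament : {X : Set} → Rel₀ X → Set
IsTournament {X} E = IsDigraph E × (∀ x y → ¬ x ≡ y → E x y ⊎ E y x)

Perm : Set
Perm = ℕ ↔ ℕ

app : Perm → ℕ → ℕ
app = Inverse.to

Tuple : ℕ → Set → Set
Tuple n X = Fin n → X

-- ā ≅ b̄ : a_i ↦ b_i is a well-defined isomorphism (bijection) of
-- induced subdigraphs (possibly between different digraphs).
TupIso : {X Y : Set} (E₁ : Rel₀ X) (E₂ : Rel₀ Y) {n : ℕ} →
         Tuple n X → Tuple n Y → Set
TupIso E₁ E₂ {n} a b =
  (∀ i j → (a i ≡ a j) ⇔ (b i ≡ b j)) ×
  (∀ i j → E₁ (a i) (a j) ⇔ E₂ (b i) (b j))

IsAut : Rel₀ ℕ → Perm → Set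
IsAut E σ = ∀ x y → E x y ⇔ E (app σ x) (app σ y)

IsHomogeneous : Rel₀ ℕ → Set
IsHomogeneous E =
  ∀ n (a b : Tuple n ℕ) → TupIso E E a b →
  ∃[ σ ] (IsAut E σ × (∀ i → app σ (a i) ≡ b i))

Embeds : {n : ℕ} → Rel₀ (Fin n) → Rel₀ ℕ → Set
Embeds {n} R E =
  ∃[ e ] (Injective _≡_ _≡_ e × (∀ i j → R i j ⇔ E (e i) (e j)))

IsGenericDigraph : Rel₀ ℕ → Set₁
IsGenericDigraph E =
  IsDigraph E × IsHomogeneous E ×
  (∀ n (R : Rel₀ (Fin n)) → IsDigraph R → Embeds R E)

IsRandomTournament : Rel₀ ℕ → Set₁
IsRandomTournament E =
  IsTournament E × IsHomogeneous E ×
  (∀ n (R : Rel₀ (Fin n)) → IsTournament R → Embeds R E)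

IsSubgroup : (Perm → Set) → Set
IsSubgroup G =
  G (↔-id ℕ) ×
  (∀ f g → G f → G g → G (f ↔-∘ g)) ×
  (∀ f → G f → G (↔-sym f))

-- Closedness in the topology of pointwise convergence: every permutation
-- which agrees on each finite tuple with some element of G lies in G.
IsClosed : (Perm → Set) → Set
IsClosed G =
  ∀ f → (∀ n (a : Tuple n ℕ) → ∃[ g ] (G g × (∀ i → app g (a i) ≡ app f (a i)))) →
  G f

IsClosedSubgroup : (Perm → Set) → Set
IsClosedSubgroup G = IsSubgroup G × IsClosed G

ContainsAut : Rel₀ ℕ → (Perm → Set) → Set
ContainsAut E G = ∀ σ → IsAut E σ → G σ

TG : (E_D E_T : Rel₀ ℕ) → (Perm → Set) → Perm → Set
TG E_D E_T G f =
  ∀ n (a : Tuple n ℕ) →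
  ∃[ g ] (G g × ∃[ b ] (TupIso E_T E_D a b ×
                       TupIso E_T E_D (app f ∘ a) (app g ∘ b)))

module Submission where

-- Write a ≅ b for TupIso E_T E a b (a tuple of the tournament
-- against a tuple of the generic digraph).  Since ≅ composes with
-- isomorphisms inside either structure, the defining condition of T(G),
--   a ≅ b  and  f a ≅ g b  for some g ∈ G and b,
-- is manipulated by purely "tuple-level" steps:
--   * copies: every tuple of any digraph has a ≅-copy in a digraph into
--     which all finite digraphs embed (send the induced subdigraph on the
--     distinct entries of the tuple into it);
--   * Aut(E_T) ⊆ T(G): take g = id and a copy b of a; σ a ≅ a ≅ b;
--   * inverses: a witness f⁻¹a ≅ b, a ≅ g b for f at f⁻¹a gives the
--     witness a ≅ g b, f⁻¹a ≅ g⁻¹(g b) for f⁻¹ at a;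
--   * composition: for f(g a) we have witnesses g₁ b₁ ≅ g a ≅ b₂; by
--     homogeneity of E an automorphism σ ∈ G maps g₁ b₁ to b₂, and g₂σg₁
--     witnesses f∘g;
--   * closedness holds for any G, since the condition is about finite
--     tuples only.

open import Defs
open import Data.Product using (_×_; _,_; proj₁; proj₂; ∃-syntax)
open import Data.Nat using (ℕ; suc; _≟_)
open import Data.Fin using (Fin; zero; suc)
open import Data.Empty using (⊥-elim)
open import Relation.Nullary using (yes; no)
open import Relation.Binary.Definitions using (DecidableEquality)
open import Relation.Binary.PropositionalEquality
  using (_≡_; refl; sym; trans; cong)
open import Function using (_∘_)
open import Function.Bundles using (_⇔_; Inverse; Injection; mk⇔)
open import Function.Properties.Inverse using (↔⇒↣)
open import Function.Definitions using (Injective)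
open import Function.Construct.Identity using (↔-id; ⇔-id)
open import Function.Construct.Composition using (_↔-∘_; _⇔-∘_)
open import Function.Construct.Symmetry using (↔-sym; ⇔-sym)

cong-⇔ : {A B : Set} (R : A → B → Set) {x x′ : A} {y y′ : B} →
         x ≡ x′ → y ≡ y′ → R x y ⇔ R x′ y′
cong-⇔ R refl refl = ⇔-id _

tupIso-sym : {X Y : Set} (E₁ : Rel₀ X) (E₂ : Rel₀ Y) {n : ℕ} {a : Tuple n X} {b : Tuple n Y} →
             TupIso E₁ E₂ a b → TupIso E₂ E₁ b a
tupIso-sym _ _ (same , edge) = (λ i j → ⇔-sym (same i j)) , (λ i j → ⇔-sym (edge i j))

tupIso-trans : {X Y Z : Set} (E₁ : Rel₀ X) (E₂ : Rel₀ Y) (E₃ : Rel₀ Z) {n : ℕ}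
               {a : Tuple n X} {b : Tuple n Y} {c : Tuple n Z} →
               TupIso E₁ E₂ a b → TupIso E₂ E₃ b c → TupIso E₁ E₃ a c
tupIso-trans _ _ _ (same , edge) (same′ , edge′) =
  (λ i j → same′ i j ⇔-∘ same i j) , (λ i j → edge′ i j ⇔-∘ edge i j)

tupIso-resp : {X Y : Set} (E₁ : Rel₀ X) (E₂ : Rel₀ Y) {n : ℕ}
              {a a′ : Tuple n X} {b b′ : Tuple n Y} →
              (∀ i → a i ≡ a′ i) → (∀ i → b i ≡ b′ i) →
              TupIso E₁ E₂ a b → TupIso E₁ E₂ a′ b′
tupIso-resp E₁ E₂ ea eb (same , edge) =
  (λ i j → cong-⇔ _≡_ (eb i) (eb j) ⇔-∘ (same i j ⇔-∘ cong-⇔ _≡_ (sym (ea i)) (sym (ea j)))) ,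
  (λ i j → cong-⇔ E₂ (eb i) (eb j) ⇔-∘ (edge i j ⇔-∘ cong-⇔ E₁ (sym (ea i)) (sym (ea j))))

aut-tupIso : (E : Rel₀ ℕ) (σ : Perm) → IsAut E σ →
             ∀ {n} (a : Tuple n ℕ) → TupIso E E a (app σ ∘ a)
aut-tupIso E σ σ-aut a =
  (λ i j → mk⇔ (cong (app σ)) (Injection.injective (↔⇒↣ σ))) , (λ i j → σ-aut (a i) (a j))

-- Canonical indices: for a tuple a over a set with decidable equality,
-- firstIndex a x d is the first index at which the value x occurs (d being
-- a witness that it occurs at all).  It picks one representative index per
-- value, which removes repetitions from a tuple.
module CanonicalIndex {A : Set} (_≟A_ : DecidableEquality A) where

  firstIndex : ∀ {n} → Tuple n A → A → Fin n → Fin n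
  firstIndex {suc n} a x d with a zero ≟A x
  ... | yes _ = zero
  firstIndex {suc n} a x zero    | no _ = zero
  firstIndex {suc n} a x (suc d) | no _ = suc (firstIndex (a ∘ suc) x d)

  firstIndex-correct : ∀ {n} (a : Tuple n A) x d → a d ≡ x → a (firstIndex a x d) ≡ x
  firstIndex-correct {suc n} a x d ad≡x with a zero ≟A x
  ... | yes a0≡x = a0≡x
  firstIndex-correct {suc n} a x zero    ad≡x | no a0≢x = ⊥-elim (a0≢x ad≡x)
  firstIndex-correct {suc n} a x (suc d) ad≡x | no _    = firstIndex-correct (a ∘ suc) x d ad≡x

  firstIndex-unique : ∀ {n} (a : Tuple n A) x d d′ → a d ≡ x → a d′ ≡ x →
                      firstIndex a x d ≡ firstIndex a x d′
  firstIndex-unique {suc n} a x d d′ ad≡x ad′≡x with a zero ≟A x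
  ... | yes _ = refl
  firstIndex-unique {suc n} a x zero    d′      ad≡x ad′≡x | no a0≢x = ⊥-elim (a0≢x ad≡x)
  firstIndex-unique {suc n} a x (suc d) zero    ad≡x ad′≡x | no a0≢x = ⊥-elim (a0≢x ad′≡x)
  firstIndex-unique {suc n} a x (suc d) (suc d′) ad≡x ad′≡x | no _ =
    cong suc (firstIndex-unique (a ∘ suc) x d d′ ad≡x ad′≡x)

  representative : ∀ {n} → Tuple n A → Fin n → Fin n
  representative a i = firstIndex a (a i) i

  representative-value : ∀ {n} (a : Tuple n A) i → a (representative a i) ≡ a i
  representative-value a i = firstIndex-correct a (a i) i refl

  representative-equal : ∀ {n} (a : Tuple n A) i j → a i ≡ a j →
                         representative a i ≡ representative a j
  representative-equal a i j ai≡aj =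
    trans (firstIndex-unique a (a i) i j refl (sym ai≡aj))
          (cong (λ x → firstIndex a x j) ai≡aj)

open CanonicalIndex _≟_

IsDigraphUniversal : Rel₀ ℕ → Set₁
IsDigraphUniversal E = ∀ n (R : Rel₀ (Fin n)) → IsDigraph R → Embeds R E

-- Every tuple a of a digraph (ℕ, E′) has an isomorphic copy in a universal
-- digraph: embed the induced digraph on indices, R i j = E′ (a i) (a j),
-- and read off the images of the representatives.  Injectivity of the
-- embedding makes equalities of the copy match those of a.
tupleCopy : {E E′ : Rel₀ ℕ} → IsDigraphUniversal E → IsDigraph E′ →
            ∀ n (a : Tuple n ℕ) → ∃[ b ] TupIso E′ E a b
tupleCopy {E} {E′} universal (irreflexive , antisymmetric) n a =
  e ∘ representative a , same , edge
  where
  R : Rel₀ (Fin n)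
  R i j = E′ (a i) (a j)

  embedding : Embeds R E
  embedding = universal n R ((λ i → irreflexive (a i)) , (λ i j → antisymmetric (a i) (a j)))

  e : Fin n → ℕ
  e = proj₁ embedding

  e-injective : Injective _≡_ _≡_ e
  e-injective = proj₁ (proj₂ embedding)

  e-preserves : ∀ i j → R i j ⇔ E (e i) (e j)
  e-preserves = proj₂ (proj₂ embedding)

  same : ∀ i j → (a i ≡ a j) ⇔ (e (representative a i) ≡ e (representative a j))
  same i j = mk⇔ (cong e ∘ representative-equal a i j) λ eq →
    trans (sym (representative-value a i))
          (trans (cong a (e-injective eq)) (representative-value a j))

  edge : ∀ i j → E′ (a i) (a j) ⇔ E (e (representative a i)) (e (representative a j))
  edge i j = e-preserves (representative a i) (representative a j)
             ⇔-∘ cong-⇔ E′ (sym (representative-value a i)) (sym (representative-value a j))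

module _ (E E_T : Rel₀ ℕ) (G : Perm → Set) where

  -- Closedness holds for every G: membership in T(G) only constrains the
  -- action of f on finite tuples.
  TG-closed : IsClosed (TG E E_T G)
  TG-closed f approx n a with approx n a
  ... | g , g∈TG , g≗f with g∈TG n a
  ... | h , h∈G , b , a≅b , ga≅hb = h , h∈G , b , a≅b , tupIso-resp E_T E g≗f (λ _ → refl) ga≅hb

  -- If G is closed under inverses, so is T(G): the witness for f at f⁻¹ a
  -- yields one for f⁻¹ at a, with the roles of b and g b exchanged.
  TG-inverse : (∀ g → G g → G (↔-sym g)) → ∀ f → TG E E_T G f → TG E E_T G (↔-sym f)
  TG-inverse G-inverse f f∈TG n a with f∈TG n (Inverse.from f ∘ a)
  ... | g , g∈G , b , f⁻¹a≅b , a≅gb =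
    ↔-sym g , G-inverse g g∈G , app g ∘ b ,
    tupIso-resp E_T E (λ i → Inverse.strictlyInverseˡ f (a i)) (λ _ → refl) a≅gb ,
    tupIso-resp E_T E (λ _ → refl) (λ i → sym (Inverse.strictlyInverseʳ g (b i))) f⁻¹a≅b

  -- For f ∘ g at a:
  -- a ≅ b₁ and g a ≅ g₁ b₁, then g a ≅ b₂ and f g a ≅ g₂ b₂; an
  -- automorphism σ with σ g₁ b₁ = b₂ gives the witness g₂ σ g₁.
  TG-compose : IsHomogeneous E → (∀ f g → G f → G g → G (f ↔-∘ g)) → ContainsAut E G →
               ∀ f g → TG E E_T G f → TG E E_T G g → TG E E_T G (f ↔-∘ g)
  TG-compose homogeneous G-compose Aut⊆G f g f∈TG g∈TG n a with g∈TG n a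
  ... | g₁ , g₁∈G , b₁ , a≅b₁ , ga≅g₁b₁ with f∈TG n (app g ∘ a)
  ... | g₂ , g₂∈G , b₂ , ga≅b₂ , fga≅g₂b₂
      with homogeneous n (app g₁ ∘ b₁) b₂ (tupIso-trans E E_T E (tupIso-sym E_T E ga≅g₁b₁) ga≅b₂)
  ... | σ , σ-aut , σg₁b₁≡b₂ =
    g₂ ↔-∘ (σ ↔-∘ g₁) ,
    G-compose g₂ (σ ↔-∘ g₁) g₂∈G (G-compose σ g₁ (Aut⊆G σ σ-aut) g₁∈G) ,
    b₁ , a≅b₁ ,
    tupIso-resp E_T E (λ _ → refl) (λ i → cong (app g₂) (sym (σg₁b₁≡b₂ i))) fga≅g₂b₂

  -- If E is universal, E_T is a digraph and id ∈ G, then Aut(E_T) ⊆ T(G):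
  -- for σ ∈ Aut(E_T) take g = id and a copy b of a, since σ a ≅ a ≅ b.
  TG-containsAut : IsDigraphUniversal E → IsDigraph E_T → G (↔-id ℕ) →
                   ContainsAut E_T (TG E E_T G)
  TG-containsAut universal digraph id∈G σ σ-aut n a with tupleCopy {E} universal digraph n a
  ... | b , a≅b = ↔-id ℕ , id∈G , b , a≅b ,
    tupIso-trans E_T E_T E (tupIso-sym E_T E_T (aut-tupIso E_T σ σ-aut a)) a≅b

mainTheorem15 : (E E_T : Rel₀ ℕ) → IsGenericDigraph E → IsRandomTournament E_T →
    (G : Perm → Set) → IsClosedSubgroup G → ContainsAut E G →
    IsClosedSubgroup (TG E E_T G) × ContainsAut E_T (TG E E_T G)
mainTheorem15 E E_T (_ , homogeneous , universal) ((digraph , _) , _) G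
              ((id∈G , G-compose , G-inverse) , _) Aut⊆G =
  ((id∈TG , TG-compose E E_T G homogeneous G-compose Aut⊆G , TG-inverse E E_T G G-inverse) ,
   TG-closed E E_T G) ,
  Aut⊆TG
  where
  Aut⊆TG : ContainsAut E_T (TG E E_T G)
  Aut⊆TG = TG-containsAut E E_T G universal digraph id∈G

  id∈TG : TG E E_T G (↔-id ℕ)
  id∈TG = Aut⊆TG (↔-id ℕ) (λ x y → ⇔-id _)
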